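{- For $n>0$, the rewriting system $\mathrm{PreColo}_2(n)$ on the alphabet $Q_n$ whose rules are $\Gamma_2(n)\cup\Delta_2(n)$, where $\Gamma_2(n)$ consists of $c_y\cdot c_x\to c_{yx}$ for $1\le x<y\le n$ and $c_x\cdot c_x\to c_{xx}$ for $1<x<n$, and $\Delta_2(n)$ consists of $c_y\cdot c_{yx}\to c_{yx}\cdot c_y$ for $1\le x<y\le n$; $c_{yy}\cdot c_x\to c_{yx}\cdot c_y$ for $1\le x<y<n$; $c_{zy}\cdot c_x\to c_y\cdot c_{zx}$ and $c_z\cdot c_{yx}\to c_y\cdot c_{zx}$ for $1\le x\le y<z\le n$ (whenever all generators occurring belong to $Q_n$); $c_{zx}\cdot c_y\to c_y\cdot c_{zx}$ for $1\le x<y<z\le n$, is a finite semi-quadratic presentation of the Chinese monoid $\mathbf{C}_n$.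
   Context: The Chinese monoid $\mathbf{C}_n$ is the monoid generated by $[n]=\{1,\ldots,n\}$ subject to the relations $zyx=yzx$ and $zxy=yzx$ for $1\le x<y<z\le n$, and $yyx=yxy$ and $yxx=xyx$ for $1\le x<y\le n$. Here $Q_n$ is the finite alphabet consisting of the symbols $c_{yx}$ for $1\le x<y\le n$, $c_{xx}$ for $1<x<n$, and $c_x$ for $1\le x\le n$; $\cdot$ denotes concatenation in $Q_n^\ast$. A rewriting system on $Q_n$ is a presentation of a monoid $\mathbf{M}$ if the quotient of $Q_n^\ast$ by the congruence generated by its rules is isomorphic to $\mathbf{M}$; it is semi-quadratic if every rule has a source of length $2$ and a target of length at most $2$. -}

module Defs where

open import Data.Nat as ℕ using (ℕ; zero; suc; _≤_)
open import Data.Fin as Fin using (Fin; toℕ)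
open import Data.List using (List; []; _∷_; _++_; length)
open import Data.List.Membership.Propositional using (_∈_)
open import Data.Product using (Σ; _×_; _,_)
open import Relation.Binary.PropositionalEquality using (_≡_)

-- Conventions: the letter i ∈ [n] = {1,…,n} is represented by the element
-- (i - 1) : Fin n, so that toℕ is order preserving and i = suc (toℕ i').

module _ {A : Set} (R : List A → List A → Set) where

  data Cong : List A → List A → Set where
    step  : ∀ u l r v → R l r → Cong (u ++ l ++ v) (u ++ r ++ v)
    crefl : ∀ {w} → Cong w w
    csym  : ∀ {w w'} → Cong w w' → Cong w' w
    ctrans : ∀ {w w' w''} → Cong w w' → Cong w' w'' → Cong w w''

data ChineseRel (n : ℕ) : List (Fin n) → List (Fin n) → Set where
  ch₁ : (x y z : Fin n) → x Fin.< y → y Fin.< z →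
        ChineseRel n (z ∷ y ∷ x ∷ []) (y ∷ z ∷ x ∷ [])
  ch₂ : (x y z : Fin n) → x Fin.< y → y Fin.< z →
        ChineseRel n (z ∷ x ∷ y ∷ []) (y ∷ z ∷ x ∷ [])
  ch₃ : (x y : Fin n) → x Fin.< y →
        ChineseRel n (y ∷ y ∷ x ∷ []) (y ∷ x ∷ y ∷ [])
  ch₄ : (x y : Fin n) → x Fin.< y →
        ChineseRel n (y ∷ x ∷ x ∷ []) (x ∷ y ∷ x ∷ [])

-- "1 < x"  for the letter x is  0 < toℕ x ;  "x < n"  is  suc (toℕ x) < n.
data Q (n : ℕ) : Set where
  c   : Fin n → Q n
  cyx : (y x : Fin n) → x Fin.< y → Q n
  cxx : (x : Fin n) → 0 ℕ.< toℕ x → suc (toℕ x) ℕ.< n → Q n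

data PreColo₂ (n : ℕ) : List (Q n) → List (Q n) → Set where
  γ₁ : (x y : Fin n) (p : x Fin.< y) →
       PreColo₂ n (c y ∷ c x ∷ []) (cyx y x p ∷ [])
  γ₂ : (x : Fin n) (p : 0 ℕ.< toℕ x) (q : suc (toℕ x) ℕ.< n) →
       PreColo₂ n (c x ∷ c x ∷ []) (cxx x p q ∷ [])
  δ₁ : (x y : Fin n) (p : x Fin.< y) →
       PreColo₂ n (c y ∷ cyx y x p ∷ []) (cyx y x p ∷ c y ∷ [])
  -- c_{yy} c_x → c_{yx} c_y,  x < y < n  (1 < y is forced by x < y)
  δ₂ : (x y : Fin n) (p : x Fin.< y) (p' : 0 ℕ.< toℕ y) (q : suc (toℕ y) ℕ.< n) →
       PreColo₂ n (cxx y p' q ∷ c x ∷ []) (cyx y x p ∷ c y ∷ [])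
  δ₃ : (x y z : Fin n) (p : x Fin.≤ y) (q : y Fin.< z) (r : x Fin.< z) →
       PreColo₂ n (cyx z y q ∷ c x ∷ []) (c y ∷ cyx z x r ∷ [])
  δ₄ : (x y z : Fin n) (p : x Fin.< y) (q : y Fin.< z) (r : x Fin.< z) →
       PreColo₂ n (c z ∷ cyx y x p ∷ []) (c y ∷ cyx z x r ∷ [])
  δ₅ : (y z : Fin n) (p : 0 ℕ.< toℕ y) (p' : suc (toℕ y) ℕ.< n) (q : y Fin.< z) →
       PreColo₂ n (c z ∷ cxx y p p' ∷ []) (c y ∷ cyx z y q ∷ [])
  δ₆ : (x y z : Fin n) (r : x Fin.< z) → x Fin.< y → y Fin.< z →
       PreColo₂ n (cyx z x r ∷ c y ∷ []) (c y ∷ cyx z x r ∷ [])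

Finite : {A : Set} → (List A → List A → Set) → Set
Finite {A} R = Σ (List (List A × List A)) λ rs → ∀ {l r} → R l r → (l , r) ∈ rs

SemiQuadratic : {A : Set} → (List A → List A → Set) → Set
SemiQuadratic R = ∀ {l r} → R l r → (length l ≡ 2) × (length r ≤ 2)

-- The monoid Q*/≈_R is isomorphic to the monoid B*/≈_S  (isomorphism of
-- the quotient monoids, given by maps on representatives).
record QuotientIso {A B : Set} (R : List A → List A → Set)
                   (S : List B → List B → Set) : Set where
  field
    to      : List A → List B
    from    : List B → List A
    to-resp   : ∀ {u v} → Cong R u v → Cong S (to u) (to v)
    from-resp : ∀ {u v} → Cong S u v → Cong R (from u) (from v)
    to-ε      : Cong S (to []) []
    to-hom    : ∀ u v → Cong S (to (u ++ v)) (to u ++ to v)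
    to-from   : ∀ w → Cong S (to (from w)) w
    from-to   : ∀ u → Cong R (from (to u)) u

IsPresentationOf : {A B : Set} → (List A → List A → Set) →
                   (List B → List B → Set) → Set
IsPresentationOf R S = QuotientIso R S

-- Reading c_{yx} and c_{xx} as the two-letter words yx and xx, every rule of
-- Γ₂(n) becomes trivial and every rule of Δ₂(n) becomes a Chinese relation.
-- Conversely, each Chinese relation is derived by contracting two of its three
-- letters with a rule of Γ₂(n), applying one rule of Δ₂(n), and expanding
-- back. Finiteness holds because Q_n is finite and the rules are semi-quadratic.
module Submission where

open import Defs
open import Data.Nat as ℕ using (ℕ; zero; suc; _<_; _≤_; z≤n; s≤s)
open import Data.Nat.Properties as ℕₚ using (≤-reflexive)
open import Data.Fin using (Fin; toℕ)
open import Data.Fin.Properties as Finₚ using (≤∧≢⇒<)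
open import Data.List
  using (List; []; _∷_; _++_; [_]; length; map; allFin; concatMap; cartesianProduct; cartesianProductWith)
open import Data.List.Properties using (++-assoc; ++-identityʳ; concatMap-++)
open import Data.List.Membership.Propositional using (_∈_; lose)
open import Data.List.Membership.Propositional.Properties
  using (∈-++⁺ˡ; ∈-++⁺ʳ; ∈-allFin; ∈-map⁺; ∈-concatMap⁺; ∈-cartesianProduct⁺; ∈-cartesianProductWith⁺)
open import Data.List.Relation.Unary.Any using (here; there)
open import Data.Product using (_×_; _,_; uncurry)
open import Relation.Binary.Bundles using (Setoid)
import Relation.Binary.Reasoning.Setoid as SetoidReasoning
open import Relation.Binary.PropositionalEquality using (_≡_; refl; sym; cong; subst₂)
open import Relation.Nullary using (yes; no; contradiction)

module _ {A : Set} {R : List A → List A → Set} where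

  Cong-reflexive : ∀ {u v} → u ≡ v → Cong R u v
  Cong-reflexive refl = crefl

  Cong-setoid : Setoid _ _
  Cong-setoid = record
    { Carrier = List A
    ; _≈_ = Cong R
    ; isEquivalence = record { refl = crefl ; sym = csym ; trans = ctrans }
    }

  Cong-rule : ∀ {l r} → R l r → Cong R l r
  Cong-rule {l} {r} l→r =
    subst₂ (Cong R) (++-identityʳ l) (++-identityʳ r) (step [] l r [] l→r)

  Cong-context : ∀ u v {a b} → Cong R a b → Cong R (u ++ a ++ v) (u ++ b ++ v)
  Cong-context u v (step u′ l r v′ l→r) =
    subst₂ (Cong R) (reassoc l) (reassoc r) (step (u ++ u′) l r (v′ ++ v) l→r)
    where
      reassoc : ∀ m → (u ++ u′) ++ m ++ v′ ++ v ≡ u ++ (u′ ++ m ++ v′) ++ v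
      reassoc m rewrite ++-assoc u′ (m ++ v′) v | ++-assoc m v′ v = ++-assoc u u′ (m ++ v′ ++ v)
  Cong-context u v crefl = crefl
  Cong-context u v (csym p) = csym (Cong-context u v p)
  Cong-context u v (ctrans p q) = ctrans (Cong-context u v p) (Cong-context u v q)

  Cong-++ : ∀ {a b a′ b′} → Cong R a b → Cong R a′ b′ → Cong R (a ++ a′) (b ++ b′)
  Cong-++ {a} {b} {a′} {b′} p q = ctrans
    (subst₂ (Cong R) (cong (a ++_) (++-identityʳ a′)) (cong (a ++_) (++-identityʳ b′))
      (Cong-context a [] q))
    (Cong-context [] b′ p)

module _ {A B : Set} {R : List A → List A → Set} {S : List B → List B → Set}
         (f : A → List B) where

  concatMap-resp-Cong :
    (∀ {l r} → R l r → Cong S (concatMap f l) (concatMap f r)) →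
    ∀ {u v} → Cong R u v → Cong S (concatMap f u) (concatMap f v)
  concatMap-resp-Cong f-resp (step u l r v l→r) =
    subst₂ (Cong S) (split l) (split r)
      (Cong-context (concatMap f u) (concatMap f v) (f-resp l→r))
    where
      split : ∀ m → concatMap f u ++ concatMap f m ++ concatMap f v ≡ concatMap f (u ++ m ++ v)
      split m rewrite concatMap-++ f u (m ++ v) | concatMap-++ f m v = refl
  concatMap-resp-Cong f-resp crefl = crefl
  concatMap-resp-Cong f-resp (csym p) = csym (concatMap-resp-Cong f-resp p)
  concatMap-resp-Cong f-resp (ctrans p q) =
    ctrans (concatMap-resp-Cong f-resp p) (concatMap-resp-Cong f-resp q)

module _ {A : Set} where

  wordsOfLength≤ : ℕ → List A → List (List A)
  wordsOfLength≤ zero    as = [ [] ]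
  wordsOfLength≤ (suc k) as = [] ∷ cartesianProductWith _∷_ as (wordsOfLength≤ k as)

  ∈-wordsOfLength≤ : ∀ {as k} → (∀ a → a ∈ as) → (w : List A) → length w ≤ k →
                     w ∈ wordsOfLength≤ k as
  ∈-wordsOfLength≤ {k = zero}  _   []      _         = here refl
  ∈-wordsOfLength≤ {k = suc k} _   []      _         = here refl
  ∈-wordsOfLength≤ {k = suc k} all (a ∷ w) (s≤s |w|≤k) =
    there (∈-cartesianProductWith⁺ _∷_ (all a) (∈-wordsOfLength≤ all w |w|≤k))

  semiQuadratic⇒finite : {R : List A → List A → Set} (as : List A) → (∀ a → a ∈ as) →
                         SemiQuadratic R → Finite R
  semiQuadratic⇒finite as all semiQuadratic =
    cartesianProduct words words , λ {l} {r} l→r →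
      let |l|≡2 , |r|≤2 = semiQuadratic l→r in
      ∈-cartesianProduct⁺ (∈-wordsOfLength≤ all l (≤-reflexive |l|≡2))
                          (∈-wordsOfLength≤ all r |r|≤2)
    where
      words : List (List A)
      words = wordsOfLength≤ 2 as

module _ {n : ℕ} where

  expand : Q n → List (Fin n)
  expand (c x)       = [ x ]
  expand (cyx y x _) = y ∷ x ∷ []
  expand (cxx x _ _) = x ∷ x ∷ []

  toChinese : List (Q n) → List (Fin n)
  toChinese = concatMap expand

  fromChinese : List (Fin n) → List (Q n)
  fromChinese = concatMap (λ x → [ c x ])

  toChinese-fromChinese : ∀ w → toChinese (fromChinese w) ≡ w
  toChinese-fromChinese []      = refl
  toChinese-fromChinese (x ∷ w) = cong (x ∷_) (toChinese-fromChinese w)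

  preColo₂⇒chinese : ∀ {l r} → PreColo₂ n l r →
                     Cong (ChineseRel n) (toChinese l) (toChinese r)
  preColo₂⇒chinese (γ₁ x y p)          = crefl
  preColo₂⇒chinese (γ₂ x p q)          = crefl
  preColo₂⇒chinese (δ₁ x y p)          = Cong-rule (ch₃ x y p)
  preColo₂⇒chinese (δ₂ x y p p′ q)     = Cong-rule (ch₃ x y p)
  preColo₂⇒chinese (δ₃ x y z x≤y q r) with x Finₚ.≟ y
  ... | yes refl = Cong-rule (ch₄ x z q)
  ... | no x≢y   = Cong-rule (ch₁ x y z (≤∧≢⇒< x≤y x≢y) q)
  preColo₂⇒chinese (δ₄ x y z p q r)    = Cong-rule (ch₁ x y z p q)
  preColo₂⇒chinese (δ₅ y z p p′ q)     = Cong-rule (ch₄ y z q)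
  preColo₂⇒chinese (δ₆ x y z r p q)    = Cong-rule (ch₂ x y z p q)

  open SetoidReasoning (Cong-setoid {R = PreColo₂ n})

  chinese⇒preColo₂ : ∀ {l r} → ChineseRel n l r →
                     Cong (PreColo₂ n) (fromChinese l) (fromChinese r)
  chinese⇒preColo₂ (ch₁ x y z x<y y<z) = begin
    c z ∷ c y ∷ c x ∷ []   ≈⟨ step [ c z ] _ _ [] (γ₁ x y x<y) ⟩
    c z ∷ cyx y x x<y ∷ [] ≈⟨ step [] _ _ [] (δ₄ x y z x<y y<z x<z) ⟩
    c y ∷ cyx z x x<z ∷ [] ≈⟨ step [ c y ] _ _ [] (γ₁ x z x<z) ⟨
    c y ∷ c z ∷ c x ∷ []   ∎
    where x<z : toℕ x < toℕ z
          x<z = ℕₚ.<-trans x<y y<z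
  chinese⇒preColo₂ (ch₂ x y z x<y y<z) = begin
    c z ∷ c x ∷ c y ∷ []   ≈⟨ step [] _ _ [ c y ] (γ₁ x z x<z) ⟩
    cyx z x x<z ∷ c y ∷ [] ≈⟨ step [] _ _ [] (δ₆ x y z x<z x<y y<z) ⟩
    c y ∷ cyx z x x<z ∷ [] ≈⟨ step [ c y ] _ _ [] (γ₁ x z x<z) ⟨
    c y ∷ c z ∷ c x ∷ []   ∎
    where x<z : toℕ x < toℕ z
          x<z = ℕₚ.<-trans x<y y<z
  chinese⇒preColo₂ (ch₃ x y x<y) = begin
    c y ∷ c y ∷ c x ∷ []   ≈⟨ step [ c y ] _ _ [] (γ₁ x y x<y) ⟩
    c y ∷ cyx y x x<y ∷ [] ≈⟨ step [] _ _ [] (δ₁ x y x<y) ⟩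
    cyx y x x<y ∷ c y ∷ [] ≈⟨ step [] _ _ [ c y ] (γ₁ x y x<y) ⟨
    c y ∷ c x ∷ c y ∷ []   ∎
  chinese⇒preColo₂ (ch₄ x y x<y) = begin
    c y ∷ c x ∷ c x ∷ []   ≈⟨ step [] _ _ [ c x ] (γ₁ x y x<y) ⟩
    cyx y x x<y ∷ c x ∷ [] ≈⟨ step [] _ _ [] (δ₃ x x y ℕₚ.≤-refl x<y x<y) ⟩
    c x ∷ cyx y x x<y ∷ [] ≈⟨ step [ c x ] _ _ [] (γ₁ x y x<y) ⟨
    c x ∷ c y ∷ c x ∷ []   ∎

  fromChinese-expand : ∀ q → Cong (PreColo₂ n) (fromChinese (expand q)) [ q ]
  fromChinese-expand (c x)       = crefl
  fromChinese-expand (cyx y x p) = Cong-rule (γ₁ x y p)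
  fromChinese-expand (cxx x p q) = Cong-rule (γ₂ x p q)

  fromChinese-toChinese : ∀ u → Cong (PreColo₂ n) (fromChinese (toChinese u)) u
  fromChinese-toChinese []      = crefl
  fromChinese-toChinese (q ∷ u) =
    subst₂ (Cong (PreColo₂ n)) (sym (concatMap-++ _ (expand q) (toChinese u))) refl
      (Cong-++ (fromChinese-expand q) (fromChinese-toChinese u))

  preColo₂-presents-chinese : IsPresentationOf (PreColo₂ n) (ChineseRel n)
  preColo₂-presents-chinese = record
    { to        = toChinese
    ; from      = fromChinese
    ; to-resp   = concatMap-resp-Cong expand preColo₂⇒chinese
    ; from-resp = concatMap-resp-Cong (λ x → [ c x ]) chinese⇒preColo₂
    ; to-ε      = crefl
    ; to-hom    = λ u v → Cong-reflexive (concatMap-++ expand u v)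
    ; to-from   = λ w → Cong-reflexive (toChinese-fromChinese w)
    ; from-to   = fromChinese-toChinese
    }

  preColo₂-semiQuadratic : SemiQuadratic (PreColo₂ n)
  preColo₂-semiQuadratic (γ₁ _ _ _)         = refl , s≤s z≤n
  preColo₂-semiQuadratic (γ₂ _ _ _)         = refl , s≤s z≤n
  preColo₂-semiQuadratic (δ₁ _ _ _)         = refl , ℕₚ.≤-refl
  preColo₂-semiQuadratic (δ₂ _ _ _ _ _)     = refl , ℕₚ.≤-refl
  preColo₂-semiQuadratic (δ₃ _ _ _ _ _ _)   = refl , ℕₚ.≤-refl
  preColo₂-semiQuadratic (δ₄ _ _ _ _ _ _)   = refl , ℕₚ.≤-refl
  preColo₂-semiQuadratic (δ₅ _ _ _ _ _)     = refl , ℕₚ.≤-refl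
  preColo₂-semiQuadratic (δ₆ _ _ _ _ _ _)   = refl , ℕₚ.≤-refl

  cyx? : Fin n → Fin n → List (Q n)
  cyx? y x with x Finₚ.<? y
  ... | yes x<y = [ cyx y x x<y ]
  ... | no _    = []

  cxx? : Fin n → List (Q n)
  cxx? x with 0 ℕ.<? toℕ x | suc (toℕ x) ℕ.<? n
  ... | yes 1<x | yes x<n = [ cxx x 1<x x<n ]
  ... | _       | _       = []

  allQ : List (Q n)
  allQ = map c (allFin n)
      ++ concatMap (uncurry cyx?) (cartesianProduct (allFin n) (allFin n))
      ++ concatMap cxx? (allFin n)

  ∈-cyx? : ∀ y x x<y → cyx y x x<y ∈ cyx? y x
  ∈-cyx? y x x<y with x Finₚ.<? y
  ... | yes x<y′ rewrite ℕₚ.<-irrelevant x<y x<y′ = here refl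
  ... | no x≮y   = contradiction x<y x≮y

  ∈-cxx? : ∀ x 1<x x<n → cxx x 1<x x<n ∈ cxx? x
  ∈-cxx? x 1<x x<n with 0 ℕ.<? toℕ x | suc (toℕ x) ℕ.<? n
  ... | yes 1<x′ | yes x<n′ rewrite ℕₚ.<-irrelevant 1<x 1<x′ | ℕₚ.<-irrelevant x<n x<n′ = here refl
  ... | no 1≮x   | _        = contradiction 1<x 1≮x
  ... | yes _    | no x≮n   = contradiction x<n x≮n

  ∈-allQ : ∀ q → q ∈ allQ
  ∈-allQ (c x) = ∈-++⁺ˡ (∈-map⁺ c (∈-allFin x))
  ∈-allQ (cyx y x x<y) = ∈-++⁺ʳ (map c (allFin n)) (∈-++⁺ˡ (∈-concatMap⁺ (uncurry cyx?)
    (lose (∈-cartesianProduct⁺ (∈-allFin y) (∈-allFin x)) (∈-cyx? y x x<y))))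
  ∈-allQ (cxx x 1<x x<n) = ∈-++⁺ʳ (map c (allFin n)) (∈-++⁺ʳ _ (∈-concatMap⁺ cxx?
    (lose (∈-allFin x) (∈-cxx? x 1<x x<n))))

mainTheorem12 : (n : ℕ) → 0 < n →
    Finite (PreColo₂ n) × SemiQuadratic (PreColo₂ n)
      × IsPresentationOf (PreColo₂ n) (ChineseRel n)
mainTheorem12 n _ =
  semiQuadratic⇒finite allQ ∈-allQ preColo₂-semiQuadratic ,
  preColo₂-semiQuadratic ,
  preColo₂-presents-chinese
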